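{- For all closed terms $P$ and $Q$: $P\equiv_{st}Q$ if and only if $P=_{st}Q$.
   Context: Fix a finite non-empty set $A$ of atomic propositions. Closed terms are built from $T$, $F$, $a\in A$ by conditional composition $P\triangleleft Q\triangleright R$. A reactive valuation algebra (RVA) is a set $RV$ with elements $T_{RV},F_{RV}$ and for each $a\in A$ functions $y_a:RV\to\{T,F\}$, $\partial_a:RV\to RV$ with $y_a(T_{RV})=T$, $y_a(F_{RV})=F$, $\partial_a(T_{RV})=T_{RV}$, $\partial_a(F_{RV})=F_{RV}$. For closed $P$ and $H\in RV$: $T/H=T$, $F/H=F$, $a/H=y_a(H)$, $\partial_T(H)=\partial_F(H)=H$; $(P\triangleleft Q\triangleright R)/H=P/\partial_Q(H)$ and $\partial_{P\triangleleft Q\triangleright R}(H)=\partial_P(\partial_Q(H))$ if $Q/H=T$, and $R/\partial_Q(H)$ resp. $\partial_R(\partial_Q(H))$ if $Q/H=F$. The variety $st$ is the class of RVAs with $y_a(\partial_b(H))=y_a(H)$ for all $a,b\in A$, $H$. $P\equiv_{st}Q$ means $P/H=Q/H$ for all RVAs in $st$ and all $H$; $=_{st}$ is the largest congruence (w.r.t. conditional composition) on closed terms contained in $\equiv_{st}$. -}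

module Defs where

open import Data.Bool using (Bool; true; false)
open import Data.Product using (Σ; _×_; _,_)
open import Relation.Binary.PropositionalEquality using (_≡_)
open import Level using (Level; _⊔_) renaming (suc to lsuc; zero to lzero)

-- Closed terms over a set A of atomic propositions.
-- _◁_▷_ P Q R  is the conditional composition  P ◁ Q ▷ R  (Q is the condition).
data Term (A : Set) : Set where
  T F : Term A
  atom : A → Term A
  _◁_▷_ : Term A → Term A → Term A → Term A

-- Truth values {T,F} are represented by Bool (true = T, false = F).
record RVA (A : Set) : Set₁ where
  field
    Carrier : Set
    Tᵥ Fᵥ : Carrier
    y : A → Carrier → Bool
    ∂ : A → Carrier → Carrier
    y-T : ∀ a → y a Tᵥ ≡ true
    y-F : ∀ a → y a Fᵥ ≡ false
    ∂-T : ∀ a → ∂ a Tᵥ ≡ Tᵥ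
    ∂-F : ∀ a → ∂ a Fᵥ ≡ Fᵥ

module _ {A : Set} (R : RVA A) where
  open RVA R

  mutual
    _/_ : Term A → Carrier → Bool
    T / H = true
    F / H = false
    atom a / H = y a H
    (P ◁ Q ▷ S) / H with Q / H
    ... | true  = P / ∂ₜ Q H
    ... | false = S / ∂ₜ Q H

    ∂ₜ : Term A → Carrier → Carrier
    ∂ₜ T H = H
    ∂ₜ F H = H
    ∂ₜ (atom a) H = ∂ a H
    ∂ₜ (P ◁ Q ▷ S) H with Q / H
    ... | true  = ∂ₜ P (∂ₜ Q H)
    ... | false = ∂ₜ S (∂ₜ Q H)

InSt : {A : Set} → RVA A → Set
InSt {A} R = ∀ (a b : A) (H : RVA.Carrier R) → RVA.y R a (RVA.∂ R b H) ≡ RVA.y R a H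

_≡st_ : {A : Set} → Term A → Term A → Set₁
_≡st_ {A} P Q = (R : RVA A) → InSt R → (H : RVA.Carrier R) → _/_ R P H ≡ _/_ R Q H

record IsCongruence {A : Set} (C : Term A → Term A → Set₁) : Set₁ where
  field
    refl′  : ∀ P → C P P
    sym′   : ∀ {P Q} → C P Q → C Q P
    trans′ : ∀ {P Q S} → C P Q → C Q S → C P S
    cong′  : ∀ {P P′ Q Q′ S S′} → C P P′ → C Q Q′ → C S S′ →
             C (P ◁ Q ▷ S) (P′ ◁ Q′ ▷ S′)

-- P =st Q : the largest congruence contained in ≡st, i.e. P and Q are related
-- by some congruence contained in ≡st (this is the largest such congruence
-- whenever one exists, as the paper asserts).
_=st_ : {A : Set} → Term A → Term A → Set₂
_=st_ {A} P Q = Σ (Term A → Term A → Set₁) λ C →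
  IsCongruence C × (∀ {U V} → C U V → U ≡st V) × C P Q

-- In an RVA of the variety st, derivation by a term never changes the atomic
-- valuation, so P / H depends only on the atoms' values at H, and evaluating
-- P ◁ Q ▷ S amounts to "if Q / H then P / H else S / H". Hence ≡st is itself a
-- congruence; being contained in itself it is the largest one contained in ≡st.
module Submission where

open import Defs
open import Data.Nat using (ℕ; suc)
open import Data.Fin using (Fin)
open import Data.Product using (_×_; _,_)
open import Data.Bool using (true; false; if_then_else_)
open import Function using (id)
open import Relation.Binary.PropositionalEquality
  using (_≡_; refl; sym; trans; cong; cong₂; module ≡-Reasoning)

module _ {A : Set} (R : RVA A) (st : InSt R) where
  open RVA R

  SameAtoms : Carrier → Carrier → Set
  SameAtoms G H = ∀ a → y a G ≡ y a H

  y-∂ₜ : ∀ P H → SameAtoms (∂ₜ R P H) H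
  y-∂ₜ T H a = refl
  y-∂ₜ F H a = refl
  y-∂ₜ (atom b) H a = st a b H
  y-∂ₜ (P ◁ Q ▷ S) H a with _/_ R Q H
  ... | true  = trans (y-∂ₜ P (∂ₜ R Q H) a) (y-∂ₜ Q H a)
  ... | false = trans (y-∂ₜ S (∂ₜ R Q H) a) (y-∂ₜ Q H a)

  ∂ₜ-preserves-SameAtoms : ∀ Q {G H} → SameAtoms G H → SameAtoms (∂ₜ R Q G) (∂ₜ R Q H)
  ∂ₜ-preserves-SameAtoms Q {G} {H} e a =
    trans (y-∂ₜ Q G a) (trans (e a) (sym (y-∂ₜ Q H a)))

  /-respects-SameAtoms : ∀ P {G H} → SameAtoms G H → _/_ R P G ≡ _/_ R P H
  /-respects-SameAtoms T e = refl
  /-respects-SameAtoms F e = refl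
  /-respects-SameAtoms (atom a) e = e a
  /-respects-SameAtoms (P ◁ Q ▷ S) {G} {H} e
    with _/_ R Q G | _/_ R Q H | /-respects-SameAtoms Q e
  ... | true  | .true  | refl = /-respects-SameAtoms P (∂ₜ-preserves-SameAtoms Q e)
  ... | false | .false | refl = /-respects-SameAtoms S (∂ₜ-preserves-SameAtoms Q e)

  /-◁▷ : ∀ P Q S H →
         _/_ R (P ◁ Q ▷ S) H ≡ (if _/_ R Q H then _/_ R P H else _/_ R S H)
  /-◁▷ P Q S H with _/_ R Q H
  ... | true  = /-respects-SameAtoms P (y-∂ₜ Q H)
  ... | false = /-respects-SameAtoms S (y-∂ₜ Q H)

≡st-cong : {A : Set} {P P′ Q Q′ S S′ : Term A} →
           P ≡st P′ → Q ≡st Q′ → S ≡st S′ → (P ◁ Q ▷ S) ≡st (P′ ◁ Q′ ▷ S′)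
≡st-cong {P = P} {P′} {Q} {Q′} {S} {S′} p q s R st H = begin
  _/_ R (P ◁ Q ▷ S) H                                  ≡⟨ /-◁▷ R st P Q S H ⟩
  (if _/_ R Q H then _/_ R P H else _/_ R S H)         ≡⟨ cong₂ (λ b x → if b then x else _/_ R S H)
                                                                (q R st H) (p R st H) ⟩
  (if _/_ R Q′ H then _/_ R P′ H else _/_ R S H)       ≡⟨ cong (λ z → if _/_ R Q′ H then _/_ R P′ H else z)
                                                                (s R st H) ⟩
  (if _/_ R Q′ H then _/_ R P′ H else _/_ R S′ H)      ≡⟨ sym (/-◁▷ R st P′ Q′ S′ H) ⟩
  _/_ R (P′ ◁ Q′ ▷ S′) H                               ∎
  where open ≡-Reasoning

≡st-isCongruence : {A : Set} → IsCongruence {A} _≡st_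
≡st-isCongruence = record
  { refl′  = λ P R st H → refl
  ; sym′   = λ p R st H → sym (p R st H)
  ; trans′ = λ p q R st H → trans (p R st H) (q R st H)
  ; cong′  = λ {P P′ Q Q′ S S′} → ≡st-cong {P = P} {P′} {Q} {Q′} {S} {S′}
  }

mainTheorem16 : (n : ℕ) (P Q : Term (Fin (suc n))) →
    (P ≡st Q → P =st Q) × (P =st Q → P ≡st Q)
mainTheorem16 n P Q = (λ P≡Q → _≡st_ , ≡st-isCongruence , id , P≡Q)
                    , (λ { (C , _ , C⊆≡st , PCQ) → C⊆≡st PCQ })
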